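{- Let $\mathbb{V}$ be a cartesian category with distributive countable coproducts and $p:\mathbb{P}\to\mathbb{V}$ a fibration for assertion logic. Let $\{\mathrm{true},\mathrm{false}\in\mathbb{V}(1,B)\}$ be a coproduct in $\mathbb{V}$, let $X\in\mathbb{V}$, $\psi\in\mathbb{P}_X$ and $e\in\mathbb{V}(X,B)$. Put $f_{\mathrm{true}}=\langle\mathrm{id}_X,\mathrm{true}\circ!_X\rangle$, $f_{\mathrm{false}}=\langle\mathrm{id}_X,\mathrm{false}\circ!_X\rangle\in\mathbb{V}(X,X\times B)$ and $\mathrm{Im}=\langle\mathrm{id}_X,e\rangle_*\psi\in\mathbb{P}_{X\times B}$. Then $$\psi\wedge\mathrm{Eq}(e,\mathrm{true}\circ!_X)=f_{\mathrm{true}}^*\mathrm{Im}\quad\text{and}\quad\psi\wedge\mathrm{Eq}(e,\mathrm{false}\circ!_X)=f_{\mathrm{false}}^*\mathrm{Im}.$$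
   Context: A functor $p:\mathbb{P}\to\mathbb{V}$ is a posetal fibration if each fibre $\mathbb{P}_X$ (objects above $X$, morphisms above $\mathrm{id}_X$) is a poset and every $f\in\mathbb{V}(X,p\psi)$ has a cartesian lifting; this yields monotone reindexing maps $f^*:\mathbb{P}_Y\to\mathbb{P}_X$, functorial contravariantly. A fibration for assertion logic over $\mathbb{V}$ (cartesian, with distributive countable coproducts) is a posetal fibration such that: (1) each $\mathbb{P}_X$ is a distributive lattice with finite meets $\top,\wedge$ and countable joins $\bot,\vee$; (2) each $f^*$ preserves finite meets and countable joins; (3) reindexing along $c_{X,Y}=\langle\pi_1,\pi_2,\pi_2\rangle:X\times Y\to X\times Y\times Y$ has a left adjoint $\mathrm{Eq}_{X,Y}$ satisfying the Beck–Chevalley condition $\mathrm{Eq}_{Z,Y}\circ(f\times Y)^*=(f\times Y\times Y)^*\circ\mathrm{Eq}_{X,Y}$ and Frobenius $\mathrm{Eq}_{X,Y}(c^*\psi\wedge\phi)=\psi\wedge\mathrm{Eq}_{X,Y}\phi$; (4) reindexing along $\pi_1:X\times Y\to X$ has a left adjoint $\exists_{X,Y}$ satisfying Beck–Chevalley $\exists_{X,Y}\circ(f\times Y)^*=f^*\circ\exists_{Z,Y}$ and Frobenius $\exists_{X,Y}(\pi_1^*\psi\wedge\phi)=\psi\wedge\exists_{X,Y}\phi$. For $f,g\in\mathbb{V}(X,Y)$, $\mathrm{Eq}(f,g)=\langle\mathrm{id}_X,f,g\rangle^*\mathrm{Eq}_{X,Y}(\top_{X\times Y})\in\mathbb{P}_X$.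 For $f\in\mathbb{V}(X,Y)$, $f_*:\mathbb{P}_X\to\mathbb{P}_Y$ denotes the left adjoint of $f^*$, given by $f_*\psi=\exists_{Y,X}(\pi_2^*\psi\wedge\mathrm{Eq}(f\circ\pi_2,\pi_1))$ with $\pi_1:Y\times X\to Y$, $\pi_2:Y\times X\to X$. $!_X:X\to1$ is the terminal map. -}

module Defs where

open import Level using (Level; _⊔_) renaming (suc to lsuc)
open import Data.Nat using (ℕ)
open import Data.Product using (Σ; _×_; _,_; proj₁; proj₂)
open import Relation.Binary.PropositionalEquality using (_≡_)
open import Function.Definitions using (Injective)

record Category (o h : Level) : Set (lsuc (o ⊔ h)) where
  infixr 9 _∘_
  field
    Obj   : Set o
    Hom   : Obj → Obj → Set h
    id    : ∀ {X} → Hom X X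
    _∘_   : ∀ {X Y Z} → Hom Y Z → Hom X Y → Hom X Z
    idˡ   : ∀ {X Y} (f : Hom X Y) → id ∘ f ≡ f
    idʳ   : ∀ {X Y} (f : Hom X Y) → f ∘ id ≡ f
    assoc : ∀ {W X Y Z} (f : Hom Y Z) (g : Hom X Y) (k : Hom W X) →
            (f ∘ g) ∘ k ≡ f ∘ (g ∘ k)

-- A set is countable if it injects into ℕ (this includes finite sets).
Countable : Set → Set
Countable I = Σ (I → ℕ) (λ c → Injective _≡_ _≡_ c)

module _ {o h : Level} (C : Category o h) where
  open Category C

  IsIso : ∀ {X Y} → Hom X Y → Set h
  IsIso {X} {Y} f = Σ (Hom Y X) (λ g → (g ∘ f ≡ id) × (f ∘ g ≡ id))

  IsCoproduct : {I : Set} (A : I → Obj) (S : Obj) (ι : (i : I) → Hom (A i) S) →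
                Set (o ⊔ h)
  IsCoproduct {I} A S ι =
    ∀ (Z : Obj) (k : (i : I) → Hom (A i) Z) →
    Σ (Hom S Z) (λ u → (∀ i → u ∘ ι i ≡ k i) ×
                       (∀ (u' : Hom S Z) → (∀ i → u' ∘ ι i ≡ k i) → u' ≡ u))

  data Two : Set where
    ₀ ₁ : Two

  IsBinaryCoproduct : {A B S : Obj} → Hom A S → Hom B S → Set (o ⊔ h)
  IsBinaryCoproduct {A} {B} {S} inl inr = IsCoproduct fam S inj
    where
    fam : Two → Obj
    fam ₀ = A
    fam ₁ = B
    inj : (i : Two) → Hom (fam i) S
    inj ₀ = inl
    inj ₁ = inr

record Cartesian {o h : Level} (C : Category o h) : Set (o ⊔ h) where
  open Category C
  infixr 7 _×₀_
  field
    𝟙      : Obj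
    !      : ∀ {X} → Hom X 𝟙
    !-uniq : ∀ {X} (f : Hom X 𝟙) → f ≡ !
    _×₀_   : Obj → Obj → Obj
    π₁     : ∀ {X Y} → Hom (X ×₀ Y) X
    π₂     : ∀ {X Y} → Hom (X ×₀ Y) Y
    ⟨_,_⟩  : ∀ {Z X Y} → Hom Z X → Hom Z Y → Hom Z (X ×₀ Y)
    π₁-β   : ∀ {Z X Y} (f : Hom Z X) (g : Hom Z Y) → π₁ ∘ ⟨ f , g ⟩ ≡ f
    π₂-β   : ∀ {Z X Y} (f : Hom Z X) (g : Hom Z Y) → π₂ ∘ ⟨ f , g ⟩ ≡ g
    ⟨⟩-η   : ∀ {Z X Y} (h : Hom Z (X ×₀ Y)) → ⟨ π₁ ∘ h , π₂ ∘ h ⟩ ≡ h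

  _⊗_ : ∀ {X Z} → Hom X Z → (Y : Obj) → Hom (X ×₀ Y) (Z ×₀ Y)
  f ⊗ Y = ⟨ f ∘ π₁ , π₂ ⟩

record CartesianDCC (o h : Level) : Set (lsuc (o ⊔ h)) where
  field
    cat  : Category o h
    cart : Cartesian cat
  open Category cat public
  open Cartesian cart public
  field
    ∐       : (I : Set) → Countable I → (I → Obj) → Obj
    ι       : (I : Set) (c : Countable I) (A : I → Obj) (i : I) → Hom (A i) (∐ I c A)
    ∐-isCop : (I : Set) (c : Countable I) (A : I → Obj) → IsCoproduct cat A (∐ I c A) (ι I c A)

  distMap : (I : Set) (c : Countable I) (X : Obj) (A : I → Obj) →
            Hom (∐ I c (λ i → X ×₀ A i)) (X ×₀ ∐ I c A)
  distMap I c X A =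
    proj₁ (∐-isCop I c (λ i → X ×₀ A i) (X ×₀ ∐ I c A)
             (λ i → ⟨ π₁ , ι I c A i ∘ π₂ ⟩))

  field
    distributive : (I : Set) (c : Countable I) (X : Obj) (A : I → Obj) →
                   IsIso cat (distMap I c X A)

-- Fibrations for assertion logic, presented through their fibres
-- (posets P X) and reindexing maps f*.

record AssertionFibration {o h : Level} (V : CartesianDCC o h) (p r : Level)
       : Set (lsuc (o ⊔ h ⊔ p ⊔ r)) where
  open CartesianDCC V
  infix 4 _≤_
  infixr 6 _∧_
  infixr 5 _∨_
  field
    P         : Obj → Set p
    _≤_       : ∀ {X} → P X → P X → Set r
    ≤-refl    : ∀ {X} {ψ : P X} → ψ ≤ ψ
    ≤-trans   : ∀ {X} {ψ φ χ : P X} → ψ ≤ φ → φ ≤ χ → ψ ≤ χ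
    ≤-antisym : ∀ {X} {ψ φ : P X} → ψ ≤ φ → φ ≤ ψ → ψ ≡ φ
    ⊤         : ∀ {X} → P X
    ⊤-max     : ∀ {X} (ψ : P X) → ψ ≤ ⊤
    _∧_       : ∀ {X} → P X → P X → P X
    ∧-lb₁     : ∀ {X} (ψ φ : P X) → ψ ∧ φ ≤ ψ
    ∧-lb₂     : ∀ {X} (ψ φ : P X) → ψ ∧ φ ≤ φ
    ∧-glb     : ∀ {X} {χ ψ φ : P X} → χ ≤ ψ → χ ≤ φ → χ ≤ ψ ∧ φ
    ⊥         : ∀ {X} → P X
    ⊥-min     : ∀ {X} (ψ : P X) → ⊥ ≤ ψ
    _∨_       : ∀ {X} → P X → P X → P X
    ∨-ub₁     : ∀ {X} (ψ φ : P X) → ψ ≤ ψ ∨ φ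
    ∨-ub₂     : ∀ {X} (ψ φ : P X) → φ ≤ ψ ∨ φ
    ∨-lub     : ∀ {X} {ψ φ χ : P X} → ψ ≤ χ → φ ≤ χ → ψ ∨ φ ≤ χ
    ⋁         : ∀ {X} (I : Set) → Countable I → (I → P X) → P X
    ⋁-ub      : ∀ {X} (I : Set) (c : Countable I) (ψ : I → P X) (i : I) → ψ i ≤ ⋁ I c ψ
    ⋁-lub     : ∀ {X} (I : Set) (c : Countable I) (ψ : I → P X) {χ : P X} →
                (∀ i → ψ i ≤ χ) → ⋁ I c ψ ≤ χ
    distrib   : ∀ {X} (ψ φ χ : P X) → ψ ∧ (φ ∨ χ) ≤ (ψ ∧ φ) ∨ (ψ ∧ χ)
    _*        : ∀ {X Y} → Hom X Y → P Y → P X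
    *-mono    : ∀ {X Y} (f : Hom X Y) {ψ φ : P Y} → ψ ≤ φ → (f *) ψ ≤ (f *) φ
    *-id      : ∀ {X} (ψ : P X) → (id *) ψ ≡ ψ
    *-∘       : ∀ {X Y Z} (g : Hom Y Z) (f : Hom X Y) (ψ : P Z) →
                ((g ∘ f) *) ψ ≡ (f *) ((g *) ψ)
    *-⊤       : ∀ {X Y} (f : Hom X Y) → (f *) ⊤ ≡ ⊤
    *-∧       : ∀ {X Y} (f : Hom X Y) (ψ φ : P Y) → (f *) (ψ ∧ φ) ≡ (f *) ψ ∧ (f *) φ
    *-⊥       : ∀ {X Y} (f : Hom X Y) → (f *) ⊥ ≡ ⊥
    *-∨       : ∀ {X Y} (f : Hom X Y) (ψ φ : P Y) → (f *) (ψ ∨ φ) ≡ (f *) ψ ∨ (f *) φ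
    *-⋁       : ∀ {X Y} (f : Hom X Y) (I : Set) (c : Countable I) (ψ : I → P Y) →
                (f *) (⋁ I c ψ) ≡ ⋁ I c (λ i → (f *) (ψ i))

  cmap : ∀ {X Y} → Hom (X ×₀ Y) ((X ×₀ Y) ×₀ Y)
  cmap = ⟨ id , π₂ ⟩

  _⊗⊗_ : ∀ {X Z} → Hom X Z → (Y : Obj) → Hom ((X ×₀ Y) ×₀ Y) ((Z ×₀ Y) ×₀ Y)
  f ⊗⊗ Y = (f ⊗ Y) ⊗ Y

  field
    EqP       : ∀ {X Y} → P (X ×₀ Y) → P ((X ×₀ Y) ×₀ Y)
    Eq-adj₁   : ∀ {X Y} {φ : P (X ×₀ Y)} {ψ : P ((X ×₀ Y) ×₀ Y)} →
                EqP φ ≤ ψ → φ ≤ (cmap *) ψ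
    Eq-adj₂   : ∀ {X Y} {φ : P (X ×₀ Y)} {ψ : P ((X ×₀ Y) ×₀ Y)} →
                φ ≤ (cmap *) ψ → EqP φ ≤ ψ
    Eq-BC     : ∀ {Z X Y} (f : Hom Z X) (φ : P (X ×₀ Y)) →
                EqP {Z} {Y} (((f ⊗ Y) *) φ) ≡ ((f ⊗⊗ Y) *) (EqP {X} {Y} φ)
    Eq-Frob   : ∀ {X Y} (ψ : P ((X ×₀ Y) ×₀ Y)) (φ : P (X ×₀ Y)) →
                EqP ((cmap *) ψ ∧ φ) ≡ ψ ∧ EqP φ
    ∃P        : ∀ {X Y} → P (X ×₀ Y) → P X
    ∃-adj₁    : ∀ {X Y} {φ : P (X ×₀ Y)} {ψ : P X} →
                ∃P φ ≤ ψ → φ ≤ ((π₁ {X} {Y}) *) ψ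
    ∃-adj₂    : ∀ {X Y} {φ : P (X ×₀ Y)} {ψ : P X} →
                φ ≤ ((π₁ {X} {Y}) *) ψ → ∃P φ ≤ ψ
    ∃-BC      : ∀ {X Z Y} (f : Hom X Z) (φ : P (Z ×₀ Y)) →
                ∃P {X} {Y} (((f ⊗ Y) *) φ) ≡ (f *) (∃P {Z} {Y} φ)
    ∃-Frob    : ∀ {X Y} (ψ : P X) (φ : P (X ×₀ Y)) →
                ∃P {X} {Y} (((π₁ {X} {Y}) *) ψ ∧ φ) ≡ ψ ∧ ∃P φ

  Eq : ∀ {X Y} → Hom X Y → Hom X Y → P X
  Eq {X} {Y} f g = (⟨ ⟨ id , f ⟩ , g ⟩ *) (EqP {X} {Y} ⊤)

  _₊ : ∀ {X Y} → Hom X Y → P X → P Y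
  _₊ {X} {Y} f ψ =
    ∃P {Y} {X} (((π₂ {Y} {X}) *) ψ ∧ Eq (f ∘ π₂ {Y} {X}) (π₁ {Y} {X}))

module Submission where

-- The image of ψ along the graph ⟨id, e⟩ can be computed explicitly:
-- ⟨id, e⟩₊ ψ = π₁*ψ ∧ Eq(e ∘ π₁, π₂), the predicate "ψ x ∧ y = e x".
-- Both inclusions come from the adjunction ⟨id, e⟩₊ ⊣ ⟨id, e⟩* and Leibniz
-- substitution for Eq, which Frobenius for Eq_{X,Y} provides. Reindexing
-- along ⟨id, b⟩ then yields ψ ∧ Eq(e, b) for every b : X → B; the theorem is
-- the case b = true ∘ ! or false ∘ !, so the coproduct hypothesis is not used.

open import Level using (Level)
open import Relation.Binary.PropositionalEquality
  using (_≡_; refl; sym; trans; cong; cong₂; isEquivalence; module ≡-Reasoning)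
open import Relation.Binary.Bundles using (Poset)
open import Data.Product using (_×_; _,_)
import Relation.Binary.Reasoning.PartialOrder as PosetReasoning
open import Defs

module _ {o h : Level} (V : CartesianDCC o h) where
  open CartesianDCC V

  ⟨⟩∘ : ∀ {W Z X Y} (a : Hom Z X) (b : Hom Z Y) (k : Hom W Z) →
        ⟨ a , b ⟩ ∘ k ≡ ⟨ a ∘ k , b ∘ k ⟩
  ⟨⟩∘ a b k = begin
    ⟨ a , b ⟩ ∘ k                                   ≡⟨ sym (⟨⟩-η _) ⟩
    ⟨ π₁ ∘ (⟨ a , b ⟩ ∘ k) , π₂ ∘ (⟨ a , b ⟩ ∘ k) ⟩ ≡⟨ cong₂ ⟨_,_⟩ (sym (assoc _ _ _)) (sym (assoc _ _ _)) ⟩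
    ⟨ (π₁ ∘ ⟨ a , b ⟩) ∘ k , (π₂ ∘ ⟨ a , b ⟩) ∘ k ⟩ ≡⟨ cong₂ (λ u v → ⟨ u ∘ k , v ∘ k ⟩) (π₁-β a b) (π₂-β a b) ⟩
    ⟨ a ∘ k , b ∘ k ⟩                               ∎
    where open ≡-Reasoning

  ⟨π₁,π₂⟩≡id : ∀ {X Y} → ⟨ π₁ {X} {Y} , π₂ ⟩ ≡ id
  ⟨π₁,π₂⟩≡id = trans (cong₂ ⟨_,_⟩ (sym (idʳ π₁)) (sym (idʳ π₂))) (⟨⟩-η id)

  ⊗∘⟨⟩ : ∀ {W X Z Y} (k : Hom X Z) (a : Hom W X) (b : Hom W Y) →
         (k ⊗ Y) ∘ ⟨ a , b ⟩ ≡ ⟨ k ∘ a , b ⟩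
  ⊗∘⟨⟩ k a b = trans (⟨⟩∘ (k ∘ π₁) π₂ ⟨ a , b ⟩)
    (cong₂ ⟨_,_⟩ (trans (assoc k π₁ _) (cong (k ∘_) (π₁-β a b))) (π₂-β a b))

  module _ {p r : Level} (F : AssertionFibration V p r) where
    open AssertionFibration F

    fibre-poset : Obj → Poset p p r
    fibre-poset X = record
      { Carrier        = P X
      ; _≈_            = _≡_
      ; _≤_            = _≤_
      ; isPartialOrder = record
        { isPreorder = record
          { isEquivalence = isEquivalence
          ; reflexive     = λ { refl → ≤-refl }
          ; trans         = ≤-trans
          }
        ; antisym    = ≤-antisym
        }
      }

    module ≤-Reasoning {X : Obj} = PosetReasoning (fibre-poset X)

    *-fuse : ∀ {X Y Z} {g : Hom Y Z} {f : Hom X Y} {k : Hom X Z} (ψ : P Z) →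
             g ∘ f ≡ k → (f *) ((g *) ψ) ≡ (k *) ψ
    *-fuse {g = g} {f} ψ refl = sym (*-∘ g f ψ)

    *-Eq : ∀ {W X Y} (k : Hom W X) (f g : Hom X Y) → (k *) (Eq f g) ≡ Eq (f ∘ k) (g ∘ k)
    *-Eq {Y = Y} k f g = begin
      (k *) ((m *) (EqP ⊤))                 ≡⟨ *-fuse (EqP ⊤) m∘k≡ ⟩
      (((k ⊗⊗ Y) ∘ m′) *) (EqP ⊤)           ≡⟨ *-∘ (k ⊗⊗ Y) m′ (EqP ⊤) ⟩
      (m′ *) (((k ⊗⊗ Y) *) (EqP ⊤))         ≡⟨ cong (m′ *) (sym (Eq-BC k ⊤)) ⟩
      (m′ *) (EqP (((k ⊗ Y) *) ⊤))          ≡⟨ cong (λ φ → (m′ *) (EqP φ)) (*-⊤ (k ⊗ Y)) ⟩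
      (m′ *) (EqP ⊤)                        ∎
      where
      open ≡-Reasoning
      m  = ⟨ ⟨ id , f ⟩ , g ⟩
      m′ = ⟨ ⟨ id , f ∘ k ⟩ , g ∘ k ⟩
      m∘k≡ : m ∘ k ≡ (k ⊗⊗ Y) ∘ m′
      m∘k≡ = begin
        m ∘ k                           ≡⟨ ⟨⟩∘ _ g k ⟩
        ⟨ ⟨ id , f ⟩ ∘ k , g ∘ k ⟩      ≡⟨ cong ⟨_, g ∘ k ⟩ (trans (⟨⟩∘ id f k) (cong ⟨_, f ∘ k ⟩ (idˡ k))) ⟩
        ⟨ ⟨ k , f ∘ k ⟩ , g ∘ k ⟩       ≡⟨ sym (cong ⟨_, g ∘ k ⟩ (trans (⊗∘⟨⟩ k id (f ∘ k)) (cong ⟨_, f ∘ k ⟩ (idʳ k)))) ⟩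
        ⟨ (k ⊗ Y) ∘ ⟨ id , f ∘ k ⟩ , g ∘ k ⟩ ≡⟨ sym (⊗∘⟨⟩ (k ⊗ Y) _ (g ∘ k)) ⟩
        (k ⊗⊗ Y) ∘ m′                   ∎

    Eq-refl : ∀ {X Y} (f : Hom X Y) → ⊤ ≤ Eq f f
    Eq-refl {X} {Y} f = begin
      ⊤                                   ≡⟨ sym (*-⊤ ⟨ id , f ⟩) ⟩
      (⟨ id , f ⟩ *) ⊤                    ≤⟨ *-mono ⟨ id , f ⟩ (Eq-adj₁ {X} {Y} ≤-refl) ⟩
      (⟨ id , f ⟩ *) ((cmap *) (EqP ⊤))   ≡⟨ *-fuse (EqP ⊤) cmap∘⟨id,f⟩ ⟩
      Eq f f                              ∎
      where
      open ≤-Reasoning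
      cmap∘⟨id,f⟩ : cmap ∘ ⟨ id , f ⟩ ≡ ⟨ ⟨ id , f ⟩ , f ⟩
      cmap∘⟨id,f⟩ = trans (⟨⟩∘ id π₂ ⟨ id , f ⟩) (cong₂ ⟨_,_⟩ (idˡ _) (π₂-β id f))

    ∧-EqP-respects-cmap : ∀ {X Y} {A A′ : P ((X ×₀ Y) ×₀ Y)} (φ : P (X ×₀ Y)) →
                          (cmap *) A ≡ (cmap *) A′ → A ∧ EqP φ ≡ A′ ∧ EqP φ
    ∧-EqP-respects-cmap {A = A} {A′} φ eq = begin
      A ∧ EqP φ                ≡⟨ sym (Eq-Frob A φ) ⟩
      EqP ((cmap *) A ∧ φ)     ≡⟨ cong (λ B → EqP (B ∧ φ)) eq ⟩
      EqP ((cmap *) A′ ∧ φ)    ≡⟨ Eq-Frob A′ φ ⟩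
      A′ ∧ EqP φ               ∎
      where open ≡-Reasoning

    Eq-subst-graph : ∀ {X Y} (f g : Hom X Y) (χ : P (X ×₀ Y)) →
                     (⟨ id , f ⟩ *) χ ∧ Eq f g ≡ (⟨ id , g ⟩ *) χ ∧ Eq f g
    Eq-subst-graph {Y = Y} f g χ = begin
      (⟨ id , f ⟩ *) χ ∧ Eq f g                   ≡⟨ cong (_∧ Eq f g) (sym (*-fuse χ (π₁-β _ g))) ⟩
      (m *) ((π₁ *) χ) ∧ (m *) (EqP ⊤)            ≡⟨ sym (*-∧ m _ _) ⟩
      (m *) ((π₁ *) χ ∧ EqP ⊤)                    ≡⟨ cong (m *) (∧-EqP-respects-cmap ⊤ (trans π₁-diag (sym shift-diag))) ⟩
      (m *) ((((π₁ ⊗ Y) *) χ) ∧ EqP ⊤)            ≡⟨ *-∧ m _ _ ⟩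
      (m *) (((π₁ ⊗ Y) *) χ) ∧ Eq f g             ≡⟨ cong (_∧ Eq f g) (*-fuse χ shift∘m) ⟩
      (⟨ id , g ⟩ *) χ ∧ Eq f g                   ∎
      where
      open ≡-Reasoning
      m = ⟨ ⟨ id , f ⟩ , g ⟩
      π₁-diag : (cmap *) ((π₁ *) χ) ≡ χ
      π₁-diag = trans (*-fuse χ (π₁-β id π₂)) (*-id χ)
      shift-diag : (cmap *) (((π₁ ⊗ Y) *) χ) ≡ χ
      shift-diag = trans (*-fuse χ (trans (⊗∘⟨⟩ π₁ id π₂) (trans (cong ⟨_, π₂ ⟩ (idʳ π₁)) ⟨π₁,π₂⟩≡id)))
                         (*-id χ)
      shift∘m : (π₁ ⊗ Y) ∘ m ≡ ⟨ id , g ⟩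
      shift∘m = trans (⊗∘⟨⟩ π₁ ⟨ id , f ⟩ g) (cong ⟨_, g ⟩ (π₁-β id f))

    Eq-subst-pair : ∀ {X W Y} (k : Hom X W) (f g : Hom X Y) (χ : P (W ×₀ Y)) →
                    (⟨ k , f ⟩ *) χ ∧ Eq f g ≡ (⟨ k , g ⟩ *) χ ∧ Eq f g
    Eq-subst-pair {Y = Y} k f g χ = begin
      (⟨ k , f ⟩ *) χ ∧ Eq f g                       ≡⟨ cong (_∧ Eq f g) (sym (*-fuse χ (k⊗Y∘ f))) ⟩
      (⟨ id , f ⟩ *) (((k ⊗ Y) *) χ) ∧ Eq f g        ≡⟨ Eq-subst-graph f g _ ⟩
      (⟨ id , g ⟩ *) (((k ⊗ Y) *) χ) ∧ Eq f g        ≡⟨ cong (_∧ Eq f g) (*-fuse χ (k⊗Y∘ g)) ⟩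
      (⟨ k , g ⟩ *) χ ∧ Eq f g                       ∎
      where
      open ≡-Reasoning
      k⊗Y∘ : ∀ u → (k ⊗ Y) ∘ ⟨ id , u ⟩ ≡ ⟨ k , u ⟩
      k⊗Y∘ u = trans (⊗∘⟨⟩ k id u) (cong ⟨_, u ⟩ (idʳ k))

    Eq-subst : ∀ {X Y} (f g : Hom X Y) (χ : P Y) → (f *) χ ∧ Eq f g ≡ (g *) χ ∧ Eq f g
    Eq-subst f g χ = begin
      (f *) χ ∧ Eq f g                        ≡⟨ cong (_∧ Eq f g) (sym (*-fuse χ (π₂-β id f))) ⟩
      (⟨ id , f ⟩ *) ((π₂ *) χ) ∧ Eq f g      ≡⟨ Eq-subst-graph f g _ ⟩
      (⟨ id , g ⟩ *) ((π₂ *) χ) ∧ Eq f g      ≡⟨ cong (_∧ Eq f g) (*-fuse χ (π₂-β id g)) ⟩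
      (g *) χ ∧ Eq f g                        ∎
      where open ≡-Reasoning

    ∧-monoˡ : ∀ {X} {ψ φ : P X} (χ : P X) → ψ ≤ φ → ψ ∧ χ ≤ φ ∧ χ
    ∧-monoˡ χ ψ≤φ = ∧-glb (≤-trans (∧-lb₁ _ χ) ψ≤φ) (∧-lb₂ _ χ)

    ∧-Eq-refl : ∀ {X Y} (ψ : P X) (f : Hom X Y) → ψ ∧ Eq f f ≡ ψ
    ∧-Eq-refl ψ f = ≤-antisym (∧-lb₁ ψ _) (∧-glb ≤-refl (≤-trans (⊤-max ψ) (Eq-refl f)))

    ₊-unit : ∀ {X Y} (k : Hom X Y) (ψ : P X) → ψ ≤ (k *) ((k ₊) ψ)
    ₊-unit {X} {Y} k ψ = begin
      ψ                                 ≡⟨ sym (∧-Eq-refl ψ k) ⟩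
      ψ ∧ Eq k k                        ≡⟨ sym restrict ⟩
      (⟨ k , id ⟩ *) Φ                  ≤⟨ *-mono ⟨ k , id ⟩ (∃-adj₁ {Y} {X} {Φ} ≤-refl) ⟩
      (⟨ k , id ⟩ *) ((π₁ *) (∃P Φ))    ≡⟨ *-fuse (∃P Φ) (π₁-β k id) ⟩
      (k *) ((k ₊) ψ)                   ∎
      where
      open ≤-Reasoning
      Φ = (π₂ *) ψ ∧ Eq (k ∘ π₂) π₁
      restrict : (⟨ k , id ⟩ *) Φ ≡ ψ ∧ Eq k k
      restrict = trans (*-∧ ⟨ k , id ⟩ _ _) (cong₂ _∧_
        (trans (*-fuse ψ (π₂-β k id)) (*-id ψ))
        (trans (*-Eq ⟨ k , id ⟩ (k ∘ π₂) π₁)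
               (cong₂ Eq (trans (assoc k π₂ _) (trans (cong (k ∘_) (π₂-β k id)) (idʳ k)))
                         (π₁-β k id))))

    ₊-least : ∀ {X Y} (k : Hom X Y) {ψ : P X} {χ : P Y} → ψ ≤ (k *) χ → (k ₊) ψ ≤ χ
    ₊-least {X} {Y} k {ψ} {χ} ψ≤k*χ = ∃-adj₂ (begin
      (π₂ *) ψ ∧ E               ≤⟨ ∧-monoˡ E (*-mono π₂ ψ≤k*χ) ⟩
      (π₂ *) ((k *) χ) ∧ E       ≡⟨ cong (_∧ E) (*-fuse χ refl) ⟩
      ((k ∘ π₂) *) χ ∧ E         ≡⟨ Eq-subst (k ∘ π₂) π₁ χ ⟩
      (π₁ *) χ ∧ E               ≤⟨ ∧-lb₁ _ E ⟩
      (π₁ *) χ                   ∎)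
      where
      open ≤-Reasoning
      E = Eq (k ∘ π₂ {Y} {X}) π₁

    Graph : ∀ {X B} → P X → Hom X B → P (X ×₀ B)
    Graph ψ e = (π₁ *) ψ ∧ Eq (e ∘ π₁) π₂

    *-Graph : ∀ {X B} (ψ : P X) (e b : Hom X B) → (⟨ id , b ⟩ *) (Graph ψ e) ≡ ψ ∧ Eq e b
    *-Graph ψ e b = trans (*-∧ ⟨ id , b ⟩ _ _) (cong₂ _∧_
      (trans (*-fuse ψ (π₁-β id b)) (*-id ψ))
      (trans (*-Eq ⟨ id , b ⟩ (e ∘ π₁) π₂)
             (cong₂ Eq (trans (assoc e π₁ _) (trans (cong (e ∘_) (π₁-β id b)) (idʳ e)))
                       (π₂-β id b))))

    graph-image : ∀ {X B} (ψ : P X) (e : Hom X B) → (⟨ id , e ⟩ ₊) ψ ≡ Graph ψ e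
    graph-image ψ e = ≤-antisym image≤graph graph≤image
      where
      open ≤-Reasoning
      Im = (⟨ id , e ⟩ ₊) ψ
      E  = Eq (e ∘ π₁) π₂
      image≤graph : Im ≤ Graph ψ e
      image≤graph = ₊-least ⟨ id , e ⟩ (begin
        ψ                              ≡⟨ sym (∧-Eq-refl ψ e) ⟩
        ψ ∧ Eq e e                     ≡⟨ sym (*-Graph ψ e e) ⟩
        (⟨ id , e ⟩ *) (Graph ψ e)     ∎)
      graph≤image : Graph ψ e ≤ Im
      graph≤image = begin
        (π₁ *) ψ ∧ E                           ≤⟨ ∧-monoˡ E (*-mono π₁ (₊-unit ⟨ id , e ⟩ ψ)) ⟩
        (π₁ *) ((⟨ id , e ⟩ *) Im) ∧ E         ≡⟨ cong (_∧ E) (*-fuse Im (trans (⟨⟩∘ id e π₁) (cong ⟨_, e ∘ π₁ ⟩ (idˡ π₁)))) ⟩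
        (⟨ π₁ , e ∘ π₁ ⟩ *) Im ∧ E             ≡⟨ Eq-subst-pair π₁ (e ∘ π₁) π₂ Im ⟩
        (⟨ π₁ , π₂ ⟩ *) Im ∧ E                 ≤⟨ ∧-lb₁ _ E ⟩
        (⟨ π₁ , π₂ ⟩ *) Im                     ≡⟨ trans (cong (λ u → (u *) Im) ⟨π₁,π₂⟩≡id) (*-id Im) ⟩
        Im                                     ∎

mainTheorem4 : ∀ {o h p r : Level} (V : CartesianDCC o h) (F : AssertionFibration V p r) →
    let open CartesianDCC V
        open AssertionFibration F
    in ∀ {B : Obj} (true false : Hom 𝟙 B) → IsBinaryCoproduct cat true false →
       ∀ (X : Obj) (ψ : P X) (e : Hom X B) →
       let ftrue  = ⟨ id , true ∘ ! ⟩
           ffalse = ⟨ id , false ∘ ! ⟩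
           Im     = (⟨ id , e ⟩ ₊) ψ
       in (ψ ∧ Eq e (true ∘ !) ≡ (ftrue *) Im)
          × (ψ ∧ Eq e (false ∘ !) ≡ (ffalse *) Im)
mainTheorem4 V F true false _ X ψ e = section (true ∘ !) , section (false ∘ !)
  where
  open CartesianDCC V
  open AssertionFibration F
  section : ∀ b → ψ ∧ Eq e b ≡ (⟨ id , b ⟩ *) ((⟨ id , e ⟩ ₊) ψ)
  section b = sym (trans (cong (⟨ id , b ⟩ *) (graph-image V F ψ e)) (*-Graph V F ψ e b))
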